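{- Let $M=p_i^{n_i}p_j^{n_j}p_k^{n_k}$ with distinct primes, and let $A,B\subset\mathbb{Z}_M$ with $A\oplus B=\mathbb{Z}_M$ such that for every $a\in A$ the set $A\cap\Lambda(a,D(M))$ is $M$-fibered in at least one of the three directions. Assume $\{m: D(M)\mid m\mid M\}\cap{\mathrm{Div}}(B)=\{M\}$. Then: (i) for every $D(M)$-grid $\Lambda$, $|\Sigma_A(\Lambda)|=|\Lambda|$; (ii) if $|A|=|\Lambda|=p_ip_jp_k$, then $A$ is contained in the union of two of the sets $\mathcal{I},\mathcal{J},\mathcal{K}$.
   Context: $A\oplus B=\mathbb{Z}_M$: every element of $\mathbb{Z}_M$ is uniquely $a+b$. $(x,m)$ for $x\in\mathbb{Z}_M$, $m\mid M$ is the gcd of $m$ with a representative of $x$; ${\mathrm{Div}}(B)=\{(b-b',M):b,b'\in B\}$. $D(M)=p_i^{n_i-1}p_j^{n_j-1}p_k^{n_k-1}$; a $D(M)$-grid is $\Lambda(x,D(M))=\{x':D(M)\mid x-x'\}$ (of size $p_ip_jp_k$). $F_\nu=\{tM/p_\nu:0\le t<p_\nu\}$, $x*F_\nu=x+F_\nu$; a set $S$ is $M$-fibered in the $p_\nu$ direction if $x\in S\Rightarrow x*F_\nu\subset S$. $\mathcal{I}=\{a\in A:a*F_i\subset A\}$, $\mathcal{J},\mathcal{K}$ analogously with $F_j,F_k$. $\Sigma_A(Z)=\{a\in A:a+b\in Z\text{ for some }b\in B\}$. -}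

module Defs where

open import Data.Nat as ℕ using (ℕ; _*_; _+_; _<_)
open import Data.Nat.GCD using (gcd)
open import Data.Integer as ℤ using (ℤ; +_; _-_; ∣_∣)
open import Data.Integer.Divisibility as ℤD using ()
open import Data.Fin using (Fin; toℕ)
open import Data.Fin.Subset using (Subset; _∈_)
open import Data.Fin.Properties using (any?)
open import Data.Vec using (tabulate)
open import Data.Product using (_×_; ∃; ∃₂; _,_)
open import Data.Sum using (_⊎_)
open import Relation.Nullary using (Dec; does)
open import Relation.Nullary.Decidable using (_×-dec_)
open import Relation.Unary using (Pred; Decidable)
open import Level using (0ℓ)
open import Relation.Binary.PropositionalEquality using (_≡_)
open import Data.Fin.Subset.Properties using (_∈?_)

Cong : ℕ → ℕ → ℕ → Set
Cong m x y = (+ m) ℤD.∣ (+ x - + y)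

-- ℤ-divisibility is ℕ-divisibility of absolute values, hence decidable.
Cong? : ∀ m x y → Dec (Cong m x y)
Cong? m x y = m Data.Nat.Divisibility.∣? ∣ + x - + y ∣
  where import Data.Nat.Divisibility

toSubset : ∀ {n} {P : Pred (Fin n) 0ℓ} → Decidable P → Subset n
toSubset P? = tabulate (λ x → does (P? x))

module _ (M : ℕ) where

  Tiling : Subset M → Subset M → Set
  Tiling A B =
    (∀ (x : Fin M) → ∃₂ λ (a b : Fin M) → a ∈ A × b ∈ B × Cong M (toℕ a + toℕ b) (toℕ x))
    × (∀ (x a a' b b' : Fin M) → a ∈ A → a' ∈ A → b ∈ B → b' ∈ B
        → Cong M (toℕ a + toℕ b) (toℕ x) → Cong M (toℕ a' + toℕ b') (toℕ x)
        → a ≡ a' × b ≡ b')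

  InDiv : Subset M → ℕ → Set
  InDiv B m = ∃₂ λ (b b' : Fin M) → b ∈ B × b' ∈ B × m ≡ gcd ∣ + toℕ b - + toℕ b' ∣ M

  -- y ∈ x * F_p  (F_p = { t M/p : 0 ≤ t < p }, with M/p the s such that s p = M)
  InFiber : ℕ → Fin M → Fin M → Set
  InFiber p x y = ∃ λ s → s * p ≡ M × ∃ λ t → t < p × Cong M (toℕ y) (toℕ x + t * s)

  Fibered : ℕ → Pred (Fin M) 0ℓ → Set
  Fibered p S = ∀ x y → S x → InFiber p x y → S y

  InGrid : ℕ → Fin M → Fin M → Set
  InGrid D x x' = Cong D (toℕ x) (toℕ x')

  Grid : ℕ → Fin M → Subset M
  Grid D x = toSubset (λ x' → Cong? D (toℕ x) (toℕ x'))

  InSigma : Subset M → Subset M → ℕ → Fin M → Fin M → Set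
  InSigma A B D x a = a ∈ A × ∃ λ b → b ∈ B × Cong D (toℕ x) (toℕ a + toℕ b)

  Sigma : Subset M → Subset M → ℕ → Fin M → Subset M
  Sigma A B D x = toSubset (λ a → (a ∈? A) ×-dec
                    any? (λ b → (b ∈? B) ×-dec Cong? D (toℕ x) (toℕ a + toℕ b)))

  InFibSet : Subset M → ℕ → Fin M → Set
  InFibSet A p a = a ∈ A × (∀ y → InFiber p a y → y ∈ A)

module Submission where

-- Sending a point y of a grid Λ to its A-summand is injective on Λ: two points of Λ with
-- the same A-summand have B-summands that are congruent modulo D = D(M), and the hypothesis on
-- Div(B) makes such summands equal.  Sending a ∈ Σ_A(Λ) to a + b, for a chosen b ∈ B with
-- a + b ∈ Λ, is injective by uniqueness of the tiling.
--
-- If |A| = p_i p_j p_k ≤ |Λ|, this forces Σ_A(Λ) = A for every grid Λ.  Were A not covered by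
-- any two of I, J, K, there would be w_k ∉ I ∪ J, w_j ∉ I ∪ K and w_i ∉ J ∪ K in A; by hypothesis
-- the piece of w_k is then fibered in direction k, and so on.  The Chinese remainder theorem
-- gives P with P ≡ w_k + b_k mod D p_i, P ≡ w_i + b_i mod D p_j and P ≡ w_j + b_j mod D p_k (all
-- w + b lie in one grid).  Write P = a + b.  If the piece of a is fibered in direction i, then, as the steps M/p_i
-- and M/p_j generate the multiples of D p_k, the fibers through a and w_j meet after adding b and
-- b_j; uniqueness of the tiling puts w_j into the piece of a, so w_j ∈ I, a contradiction.  The
-- directions j and k are symmetric.

open import Defs
open import Data.Nat as ℕ using (ℕ; zero; suc; z≤n; s≤s; NonZero)
import Data.Nat.Properties as ℕ
import Data.Nat.Divisibility as ℕ
open import Data.Nat.Tactic.RingSolver as ℕ-Solver using ()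
open import Data.Fin using (Fin; zero; suc; toℕ; fromℕ<)
open import Data.Fin.Properties using (toℕ-injective; toℕ<n; toℕ-fromℕ<; suc-injective; any?; all?; ¬∀⟶∃¬)
open import Data.Fin.Subset using (Subset; _∈_; ∣_∣; ⊤; _⊆_; inside; outside) renaming (_-_ to _─_)
open import Data.Fin.Subset.Properties using (_∈?_; x∈p∧x≢y⇒x∈p-y; x∈p⇒∣p-x∣<∣p∣; p⊆q⇒∣p∣≤∣q∣; ∣⊤∣≡n)
open import Data.Vec using (_∷_; []; here; there)
open import Data.Vec.Properties using (lookup∘tabulate; []=⇒lookup; lookup⇒[]=)
open import Data.Bool using (true)
open import Data.Nat.Primality using (Prime; prime⇒nonZero; prime⇒irreducible; ¬prime[1]; euclidsLemma)
open import Data.Nat.Coprimality using (Coprime; coprime-Bézout)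
open import Data.Nat.GCD using (gcd; gcd[m,n]∣m; gcd[m,n]∣n; gcd-greatest; module Bézout)
open import Data.Product using (_×_; _,_; ∃; ∃₂; proj₁; proj₂)
open import Data.Sum using (_⊎_; inj₁; inj₂; [_,_]′)
open import Data.Empty using (⊥; ⊥-elim)
open import Function using (_∘_; id)
open import Function.Bundles using (_⇔_; Equivalence)
open import Level using (0ℓ)
open import Relation.Nullary using (Dec; yes; no; does; ¬_)
open import Relation.Nullary.Decidable using (_×-dec_; _⊎-dec_; _→-dec_; map′)
open import Relation.Unary using (Pred; Decidable)
open import Relation.Binary using (Setoid)
open import Relation.Binary.PropositionalEquality hiding ([_])
import Relation.Binary.Reasoning.Setoid as SetoidReasoning
open import Algebra.Properties.CommutativeSemigroup ℕ.*-commutativeSemigroup using (xy∙z≈xz∙y)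

-- Integer arithmetic is opened only in this block, so that _*_ and _∣_ in the theorem are those of ℕ.
module _ where

  open import Data.Integer as ℤ using (ℤ; +_; _+_; _-_; _*_; -_; _%ℕ_; _/ℕ_)
  import Data.Integer.Properties as ℤ
  open import Data.Integer.DivMod using (n%ℕd<d; a≡a%ℕn+[a/ℕn]*n)
  open import Data.Integer.Divisibility.Signed
    using (_∣_; divides; ∣ᵤ⇒∣; ∣⇒∣ᵤ; ∣m∣n⇒∣m+n; ∣m⇒∣-m; ∣n⇒∣m*n; ∣-trans; *-monoˡ-∣; *-cancelʳ-∣)
  open import Data.Integer.Tactic.RingSolver using (solve-∀)

  ∣p∣≤∣q∣-injection : ∀ {n m} (p : Subset n) (q : Subset m) (f : Fin n → Fin m)
    → (∀ {x} → x ∈ p → f x ∈ q)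
    → (∀ {x y} → x ∈ p → y ∈ p → f x ≡ f y → x ≡ y)
    → ∣ p ∣ ℕ.≤ ∣ q ∣
  ∣p∣≤∣q∣-injection [] q f _ _ = z≤n
  ∣p∣≤∣q∣-injection (outside ∷ p) q f f∈ f-inj =
    ∣p∣≤∣q∣-injection p q (f ∘ suc) (f∈ ∘ there) (λ x y → suc-injective ∘ f-inj (there x) (there y))
  ∣p∣≤∣q∣-injection (inside ∷ p) q f f∈ f-inj =
    ℕ.≤-trans (s≤s ∣p∣≤∣q-f0∣) (x∈p⇒∣p-x∣<∣p∣ (f∈ here))
    where
    f∈q-f0 : ∀ {x} → x ∈ p → f (suc x) ∈ (q ─ f zero)
    f∈q-f0 x∈p = x∈p∧x≢y⇒x∈p-y (f∈ (there x∈p)) (λ e → 0≢suc (f-inj here (there x∈p) (sym e)))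
      where 0≢suc : ∀ {n} {x : Fin n} → zero ≢ suc x
            0≢suc ()
    ∣p∣≤∣q-f0∣ : ∣ p ∣ ℕ.≤ ∣ q ─ f zero ∣
    ∣p∣≤∣q-f0∣ = ∣p∣≤∣q∣-injection p (q ─ f zero) (f ∘ suc) f∈q-f0
      (λ x y → suc-injective ∘ f-inj (there x) (there y))

  module _ {n} {P : Pred (Fin n) 0ℓ} (P? : Decidable P) {x : Fin n} where

    ∈-toSubset⁺ : P x → x ∈ toSubset P?
    ∈-toSubset⁺ px = lookup⇒[]= x _ (trans (lookup∘tabulate _ x) (does-true (P? x)))
      where does-true : (d : Dec (P x)) → does d ≡ true
            does-true (yes _) = refl
            does-true (no ¬px) = ⊥-elim (¬px px)

    ∈-toSubset⁻ : x ∈ toSubset P? → P x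
    ∈-toSubset⁻ x∈ = true-does (P? x) (trans (sym (lookup∘tabulate _ x)) ([]=⇒lookup x∈))
      where true-does : (d : Dec (P x)) → does d ≡ true → P x
            true-does (yes px) _ = px
            true-does (no _) ()

  -- A record rather than an abbreviation, so that x, y and m can be inferred from a proof.
  infix 4 _≡_[mod_]
  record _≡_[mod_] (x y : ℤ) (m : ℕ) : Set where
    constructor ≡-mod
    field ∣-difference : + m ∣ x - y
  open _≡_[mod_] public

  module _ {m : ℕ} where

    ≡⇒≡-mod : ∀ {x y} → x ≡ y → x ≡ y [mod m ]
    ≡⇒≡-mod {x} refl = ≡-mod (divides (+ 0) (trans (ℤ.+-inverseʳ x) (sym (ℤ.*-zeroˡ (+ m)))))

    ≡-mod-refl : ∀ {x} → x ≡ x [mod m ]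
    ≡-mod-refl = ≡⇒≡-mod refl

    ≡-mod-sym : ∀ {x y} → x ≡ y [mod m ] → y ≡ x [mod m ]
    ≡-mod-sym {x} {y} (≡-mod d) = ≡-mod (subst (+ m ∣_) (negate x y) (∣m⇒∣-m d))
      where negate : ∀ x y → - (x - y) ≡ y - x
            negate = solve-∀

    ≡-mod-trans : ∀ {x y z} → x ≡ y [mod m ] → y ≡ z [mod m ] → x ≡ z [mod m ]
    ≡-mod-trans {x} {y} {z} (≡-mod d) (≡-mod d') = ≡-mod (subst (+ m ∣_) (telescope x y z) (∣m∣n⇒∣m+n d d'))
      where telescope : ∀ x y z → (x - y) + (y - z) ≡ x - z
            telescope = solve-∀

    +-cong-mod : ∀ {x y x' y'} → x ≡ y [mod m ] → x' ≡ y' [mod m ] → x + x' ≡ y + y' [mod m ]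
    +-cong-mod {x} {y} {x'} {y'} (≡-mod d) (≡-mod d') = ≡-mod (subst (+ m ∣_) (regroup x y x' y') (∣m∣n⇒∣m+n d d'))
      where regroup : ∀ x y x' y' → (x - y) + (x' - y') ≡ (x + x') - (y + y')
            regroup = solve-∀

    +-congˡ-mod : ∀ u {v w} → v ≡ w [mod m ] → u + v ≡ u + w [mod m ]
    +-congˡ-mod u = +-cong-mod (≡-mod-refl {u})

    +-cancelˡ-mod : ∀ u {v w} → u + v ≡ u + w [mod m ] → v ≡ w [mod m ]
    +-cancelˡ-mod u {v} {w} (≡-mod d) = ≡-mod (subst (+ m ∣_) (cancel u v w) d)
      where cancel : ∀ u v w → (u + v) - (u + w) ≡ v - w
            cancel = solve-∀

    *-congˡ-mod : ∀ c {x y} → x ≡ y [mod m ] → c * x ≡ c * y [mod m ]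
    *-congˡ-mod c {x} {y} (≡-mod d) = ≡-mod (subst (+ m ∣_) (distrib c x y) (∣n⇒∣m*n c d))
      where distrib : ∀ c x y → c * (x - y) ≡ c * x - c * y
            distrib = solve-∀

    multiple≡0-mod : ∀ c → c * + m ≡ + 0 [mod m ]
    multiple≡0-mod c = ≡-mod (divides c (ℤ.+-identityʳ (c * + m)))

    ≡-mod-divisor : ∀ {n x y} → n ℕ.∣ m → x ≡ y [mod m ] → x ≡ y [mod n ]
    ≡-mod-divisor n∣m (≡-mod d) = ≡-mod (∣-trans (∣ᵤ⇒∣ n∣m) d)

    ≡-mod-setoid : Setoid 0ℓ 0ℓ
    ≡-mod-setoid = record
      { Carrier = ℤ ; _≈_ = _≡_[mod m ]
      ; isEquivalence = record { refl = ≡-mod-refl ; sym = ≡-mod-sym ; trans = ≡-mod-trans } }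

  module ≡-mod-Reasoning (m : ℕ) = SetoidReasoning (≡-mod-setoid {m})

  *-scale-mod : ∀ {m x y} c → x ≡ y [mod m ] → x * + c ≡ y * + c [mod c ℕ.* m ]
  *-scale-mod {m} {x} {y} c (≡-mod d) =
    ≡-mod (subst₂ _∣_ (sym (trans (ℤ.pos-* c m) (ℤ.*-comm (+ c) (+ m)))) (distrib x y (+ c)) (*-monoˡ-∣ (+ c) d))
    where distrib : ∀ x y c → (x - y) * c ≡ x * c - y * c
          distrib = solve-∀

  *-cancelʳ-mod : ∀ {m x y} c .{{_ : NonZero c}} → x * + c ≡ y * + c [mod c ℕ.* m ] → x ≡ y [mod m ]
  *-cancelʳ-mod {m} {x} {y} c (≡-mod d) =
    ≡-mod (*-cancelʳ-∣ (+ c) (subst₂ _∣_ (trans (ℤ.pos-* c m) (ℤ.*-comm (+ c) (+ m))) (distrib x y (+ c)) d))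
    where distrib : ∀ x y c → x * c - y * c ≡ (x - y) * c
          distrib = solve-∀

  private
    m∣n<m⇒n≡0 : ∀ {m n} → m ℕ.∣ n → n ℕ.< m → n ≡ 0
    m∣n<m⇒n≡0 {n = zero} _ _ = refl
    m∣n<m⇒n≡0 {n = suc n} m∣n n<m = ⊥-elim (ℕ.<⇒≱ n<m (ℕ.∣⇒≤ m∣n))

    ≡-mod⇒≡-ordered : ∀ {m a b} → a ℕ.≤ b → b ℕ.< m → + a ≡ + b [mod m ] → a ≡ b
    ≡-mod⇒≡-ordered {m} {a} {b} a≤b b<m (≡-mod d) =
      ℕ.≤-antisym a≤b (ℕ.m∸n≡0⇒m≤n (m∣n<m⇒n≡0 m∣b∸a (ℕ.≤-<-trans (ℕ.m∸n≤m b a) b<m)))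
      where
      m∣b∸a : m ℕ.∣ b ℕ.∸ a
      m∣b∸a = subst (m ℕ.∣_) (trans (cong ℤ.∣_∣ (ℤ.m-n≡m⊖n a b)) (ℤ.∣⊖∣-≤ a≤b)) (∣⇒∣ᵤ d)

  ≡-mod⇒≡ : ∀ {m a b} → a ℕ.< m → b ℕ.< m → + a ≡ + b [mod m ] → a ≡ b
  ≡-mod⇒≡ {a = a} {b} a<m b<m a≡b with ℕ.≤-total a b
  ... | inj₁ a≤b = ≡-mod⇒≡-ordered a≤b b<m a≡b
  ... | inj₂ b≤a = sym (≡-mod⇒≡-ordered b≤a a<m (≡-mod-sym a≡b))

  ⟦_⟧ : ∀ {M} → Fin M → ℤ
  ⟦ a ⟧ = + toℕ a

  ⟦⟧-injective-mod : ∀ {M} {a b : Fin M} → ⟦ a ⟧ ≡ ⟦ b ⟧ [mod M ] → a ≡ b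
  ⟦⟧-injective-mod {a = a} {b} a≡b = toℕ-injective (≡-mod⇒≡ (toℕ<n a) (toℕ<n b) a≡b)

  ⟦+⟧ : ∀ {n} (a b : Fin n) → + (toℕ a ℕ.+ toℕ b) ≡ ⟦ a ⟧ + ⟦ b ⟧
  ⟦+⟧ a b = ℤ.pos-+ (toℕ a) (toℕ b)

  residue : (M : ℕ) .{{_ : NonZero M}} → ℤ → Fin M
  residue M z = fromℕ< (n%ℕd<d z M)

  residue-≡-mod : ∀ M .{{_ : NonZero M}} z → ⟦ residue M z ⟧ ≡ z [mod M ]
  residue-≡-mod M z = begin
    ⟦ residue M z ⟧                   ≡⟨ cong +_ (toℕ-fromℕ< (n%ℕd<d z M)) ⟩
    + (z %ℕ M)                        ≡⟨ sym (ℤ.+-identityʳ _) ⟩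
    + (z %ℕ M) + + 0                  ≈⟨ +-congˡ-mod (+ (z %ℕ M)) (≡-mod-sym (multiple≡0-mod (z /ℕ M))) ⟩
    + (z %ℕ M) + (z /ℕ M) * + M       ≡⟨ sym (a≡a%ℕn+[a/ℕn]*n z M) ⟩
    z                                 ∎
    where open ≡-mod-Reasoning M

  pos-+-* : ∀ a r e → + (a ℕ.+ r ℕ.* e) ≡ + a + + r * + e
  pos-+-* a r e = trans (ℤ.pos-+ a (r ℕ.* e)) (cong (λ z → + a + z) (ℤ.pos-* r e))

  Cong⇒≡-mod : ∀ {m x y} → Cong m x y → + x ≡ + y [mod m ]
  Cong⇒≡-mod c = ≡-mod (∣ᵤ⇒∣ c)

  ≡-mod⇒Cong : ∀ {m x y} → + x ≡ + y [mod m ] → Cong m x y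
  ≡-mod⇒Cong (≡-mod d) = ∣⇒∣ᵤ d

  ≡-mod⇒≡+multiple : ∀ {m x y} → x ≡ y [mod m ] → ∃ λ k → x ≡ y + k * + m
  ≡-mod⇒≡+multiple {m} {x} {y} (≡-mod (divides k x-y≡km)) = k , (begin
    x             ≡⟨ split x y ⟩
    y + (x - y)   ≡⟨ cong (λ t → y + t) x-y≡km ⟩
    y + k * + m   ∎)
    where open ≡-Reasoning
          split : ∀ x y → x ≡ y + (x - y)
          split = solve-∀

  prime∤prime : ∀ {p q} → Prime p → Prime q → p ≢ q → ¬ p ℕ.∣ q
  prime∤prime pp pq p≢q p∣q with prime⇒irreducible pq p∣q
  ... | inj₁ refl = ¬prime[1] pp
  ... | inj₂ p≡q = p≢q p≡q

  prime∤product : ∀ {p q r} → Prime p → Prime q → Prime r → p ≢ q → p ≢ r → ¬ p ℕ.∣ q ℕ.* r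
  prime∤product pp pq pr p≢q p≢r p∣qr =
    [ prime∤prime pp pq p≢q , prime∤prime pp pr p≢r ]′ (euclidsLemma _ _ pp p∣qr)

  coprime-prime : ∀ {p n} → Prime p → ¬ p ℕ.∣ n → Coprime p n
  coprime-prime pp p∤n {d} (d∣p , d∣n) with prime⇒irreducible pp d∣p
  ... | inj₁ d≡1 = d≡1
  ... | inj₂ refl = ⊥-elim (p∤n d∣n)

  inverse-mod : ∀ {p n} → Coprime p n → ∃ λ α → α * + n ≡ + 1 [mod p ]
  inverse-mod {p} {n} p⊥n with coprime-Bézout p⊥n
  ... | Bézout.+- x y 1+yn≡xp = - + y , ≡-mod (divides (- + x) (begin
    - + y * + n - + 1       ≡⟨ negate (+ y) (+ n) ⟩
    - (+ 1 + + y * + n)     ≡⟨ cong -_ (sym (pos-+-* 1 y n)) ⟩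
    - + (1 ℕ.+ y ℕ.* n)     ≡⟨ cong (λ z → - + z) 1+yn≡xp ⟩
    - + (x ℕ.* p)           ≡⟨ cong -_ (ℤ.pos-* x p) ⟩
    - (+ x * + p)           ≡⟨ ℤ.neg-distribˡ-* (+ x) (+ p) ⟩
    - + x * + p             ∎))
    where open ≡-Reasoning
          negate : ∀ y n → - y * n - + 1 ≡ - (+ 1 + y * n)
          negate = solve-∀
  ... | Bézout.-+ x y 1+xp≡yn = + y , ≡-mod (divides (+ x) (begin
    + y * + n - + 1         ≡⟨ cong (_- + 1) (sym (ℤ.pos-* y n)) ⟩
    + (y ℕ.* n) - + 1       ≡⟨ cong (λ z → + z - + 1) (sym 1+xp≡yn) ⟩
    + (1 ℕ.+ x ℕ.* p) - + 1 ≡⟨ cong (_- + 1) (pos-+-* 1 x p) ⟩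
    + 1 + + x * + p - + 1   ≡⟨ cancel (+ x * + p) ⟩
    + x * + p               ∎))
    where open ≡-Reasoning
          cancel : ∀ z → + 1 + z - + 1 ≡ z
          cancel = solve-∀

  idempotent-mod : ∀ {p q r} → Prime p → Prime q → Prime r → p ≢ q → p ≢ r →
    ∃ λ e → e ≡ + 1 [mod p ] × e ≡ + 0 [mod q ] × e ≡ + 0 [mod r ]
  idempotent-mod {p} {q} {r} pp pq pr p≢q p≢r =
    let α , αqr≡1 = inverse-mod (coprime-prime pp (prime∤product pp pq pr p≢q p≢r))
    in α * + (q ℕ.* r) , αqr≡1
     , ≡-mod-trans (≡⇒≡-mod (regroup α (+ r) (+ q) (q ℕ.* r) (ℤ.pos-* q r))) (multiple≡0-mod (α * + r))
     , ≡-mod-trans (≡⇒≡-mod (regroup α (+ q) (+ r) (q ℕ.* r) (trans (ℤ.pos-* q r) (ℤ.*-comm (+ q) (+ r)))))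
                   (multiple≡0-mod (α * + q))
    where regroup : ∀ α a b n → + n ≡ b * a → α * + n ≡ α * a * b
          regroup α a b n n≡ba = trans (cong (α *_) n≡ba) (swap α a b)
            where swap : ∀ α a b → α * (b * a) ≡ α * a * b
                  swap = solve-∀

  crt₃ : ∀ {p q r} → Prime p → Prime q → Prime r → p ≢ q → p ≢ r → q ≢ r → ∀ x y z →
    ∃ λ w → w ≡ x [mod p ] × w ≡ y [mod q ] × w ≡ z [mod r ]
  crt₃ pp pq pr p≢q p≢r q≢r x y z =
    let e₁ , e₁≡1 , e₁≡0[q] , e₁≡0[r] = idempotent-mod pp pq pr p≢q p≢r
        e₂ , e₂≡1 , e₂≡0[p] , e₂≡0[r] = idempotent-mod pq pp pr (≢-sym p≢q) q≢r
        e₃ , e₃≡1 , e₃≡0[p] , e₃≡0[q] = idempotent-mod pr pp pq (≢-sym p≢r) (≢-sym q≢r)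
    in x * e₁ + y * e₂ + z * e₃
     , ≡-mod-trans (combine e₁≡1 e₂≡0[p] e₃≡0[p]) (≡⇒≡-mod (pick₁ x y z))
     , ≡-mod-trans (combine e₁≡0[q] e₂≡1 e₃≡0[q]) (≡⇒≡-mod (pick₂ x y z))
     , ≡-mod-trans (combine e₁≡0[r] e₂≡0[r] e₃≡1) (≡⇒≡-mod (pick₃ x y z))
    where
    combine : ∀ {m a b c a' b' c'} → a ≡ a' [mod m ] → b ≡ b' [mod m ] → c ≡ c' [mod m ] →
      x * a + y * b + z * c ≡ x * a' + y * b' + z * c' [mod m ]
    combine a≡ b≡ c≡ = +-cong-mod (+-cong-mod (*-congˡ-mod x a≡) (*-congˡ-mod y b≡)) (*-congˡ-mod z c≡)
    pick₁ : ∀ x y z → x * + 1 + y * + 0 + z * + 0 ≡ x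
    pick₁ = solve-∀
    pick₂ : ∀ x y z → x * + 0 + y * + 1 + z * + 0 ≡ y
    pick₂ = solve-∀
    pick₃ : ∀ x y z → x * + 0 + y * + 0 + z * + 1 ≡ z
    pick₃ = solve-∀

  grid-crt : ∀ D {p q r} → Prime p → Prime q → Prime r → p ≢ q → p ≢ r → q ≢ r → ∀ {c u₁ u₂ u₃} →
    u₁ ≡ c [mod D ] → u₂ ≡ c [mod D ] → u₃ ≡ c [mod D ] →
    ∃ λ P → P ≡ u₁ [mod D ℕ.* p ] × P ≡ u₂ [mod D ℕ.* q ] × P ≡ u₃ [mod D ℕ.* r ]
  grid-crt D pp pq pr p≢q p≢r q≢r {c} u₁≡c u₂≡c u₃≡c =
    let k₁ , u₁≡ = ≡-mod⇒≡+multiple u₁≡c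
        k₂ , u₂≡ = ≡-mod⇒≡+multiple u₂≡c
        k₃ , u₃≡ = ≡-mod⇒≡+multiple u₃≡c
        z , z≡k₁ , z≡k₂ , z≡k₃ = crt₃ pp pq pr p≢q p≢r q≢r k₁ k₂ k₃
    in c + z * + D , lift z≡k₁ u₁≡ , lift z≡k₂ u₂≡ , lift z≡k₃ u₃≡
    where
    lift : ∀ {m z k u} → z ≡ k [mod m ] → u ≡ c + k * + D → c + z * + D ≡ u [mod D ℕ.* m ]
    lift z≡k u≡ = ≡-mod-trans (+-congˡ-mod c (*-scale-mod D z≡k)) (≡⇒≡-mod (sym u≡))

  private
    shift-along-fibers : ∀ x y k g α j q₁ q₂ → x ≡ y + k * g → α * q₂ ≡ + 1 + j * q₁ →
      x + - (k * α) * (g * q₂) ≡ y + - (k * j) * (g * q₁)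
    shift-along-fibers x y k g α j q₁ q₂ x≡ αq₂≡ = begin
      x + - (k * α) * (g * q₂)              ≡⟨ cong (λ z → z + - (k * α) * (g * q₂)) x≡ ⟩
      y + k * g + - (k * α) * (g * q₂)      ≡⟨ regroup y k g α q₂ ⟩
      y + k * g - k * g * (α * q₂)          ≡⟨ cong (λ z → y + k * g - k * g * z) αq₂≡ ⟩
      y + k * g - k * g * (+ 1 + j * q₁)    ≡⟨ expand y k g j q₁ ⟩
      y + - (k * j) * (g * q₁)              ∎
      where
      open ≡-Reasoning
      regroup : ∀ y k g α q₂ → y + k * g + - (k * α) * (g * q₂) ≡ y + k * g - k * g * (α * q₂)
      regroup = solve-∀
      expand : ∀ y k g j q₁ → y + k * g - k * g * (+ 1 + j * q₁) ≡ y + - (k * j) * (g * q₁)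
      expand = solve-∀

  -- The steps g q₂ and g q₁ generate the multiples of g modulo g q₁ q₂, as q₁ and q₂ are coprime.
  fibers-meet : ∀ g {q₁ q₂} → Prime q₁ → Prime q₂ → q₁ ≢ q₂ → ∀ {x y} → x ≡ y [mod g ] →
    ∃₂ λ s t → s ℕ.< q₁ × t ℕ.< q₂ ×
      x + + s * + (g ℕ.* q₂) ≡ y + + t * + (g ℕ.* q₁) [mod g ℕ.* q₂ ℕ.* q₁ ]
  fibers-meet g {q₁} {q₂} pq₁ pq₂ q₁≢q₂ {x} {y} x≡y =
    let k , x≡y+kg = ≡-mod⇒≡+multiple x≡y
        α , αq₂≡1 = inverse-mod (coprime-prime pq₁ (prime∤prime pq₁ pq₂ q₁≢q₂))
        j , αq₂≡1+jq₁ = ≡-mod⇒≡+multiple αq₂≡1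
        a = - (k * α)
        b = - (k * j)
        s = residue q₁ a
        t = residue q₂ b
    in toℕ s , toℕ t , toℕ<n s , toℕ<n t , (begin
      x + ⟦ s ⟧ * + (g ℕ.* q₂)   ≈⟨ +-congˡ-mod x (*-scale-mod (g ℕ.* q₂) (residue-≡-mod q₁ a)) ⟩
      x + a * + (g ℕ.* q₂)       ≡⟨ lift-shift k α j x≡y+kg αq₂≡1+jq₁ ⟩
      y + b * + (g ℕ.* q₁)       ≈⟨ +-congˡ-mod y (≡-mod-sym
                                      (subst (⟦ t ⟧ * + (g ℕ.* q₁) ≡ b * + (g ℕ.* q₁) [mod_]) (xy∙z≈xz∙y g q₁ q₂)
                                         (*-scale-mod (g ℕ.* q₁) (residue-≡-mod q₂ b)))) ⟩
      y + ⟦ t ⟧ * + (g ℕ.* q₁)   ∎)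
    where
    open ≡-mod-Reasoning (g ℕ.* q₂ ℕ.* q₁)
    instance
      _ = prime⇒nonZero pq₁
      _ = prime⇒nonZero pq₂
    lift-shift : ∀ k α j → x ≡ y + k * + g → α * + q₂ ≡ + 1 + j * + q₁ →
      x + - (k * α) * + (g ℕ.* q₂) ≡ y + - (k * j) * + (g ℕ.* q₁)
    lift-shift k α j x≡ αq₂≡ =
      subst₂ (λ u v → x + - (k * α) * u ≡ y + - (k * j) * v) (sym (ℤ.pos-* g q₂)) (sym (ℤ.pos-* g q₁))
        (shift-along-fibers x y k (+ g) α j (+ q₁) (+ q₂) x≡ αq₂≡)

  module Fibers (M : ℕ) {{M≢0 : NonZero M}} (A : Subset M) where

    Piece : ℕ → Fin M → Pred (Fin M) 0ℓ
    Piece D a y = y ∈ A × InGrid M D a y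

    ∈-own-piece : ∀ {D a} → a ∈ A → Piece D a a
    ∈-own-piece {a = a} a∈A = a∈A , ≡-mod⇒Cong (≡-mod-refl {x = ⟦ a ⟧})

    step : ℕ → Fin M → ℕ → Fin M
    step e a r = residue M (⟦ a ⟧ + + r * + e)

    module _ {p e : ℕ} (ep≡M : e ℕ.* p ≡ M) where

      step∈fiber : ∀ a {r} → r ℕ.< p → InFiber M p a (step e a r)
      step∈fiber a {r} r<p = e , ep≡M , r , r<p , ≡-mod⇒Cong (begin
        ⟦ step e a r ⟧              ≈⟨ residue-≡-mod M _ ⟩
        ⟦ a ⟧ + + r * + e           ≡⟨ sym (pos-+-* (toℕ a) r e) ⟩
        + (toℕ a ℕ.+ r ℕ.* e)       ∎)
        where open ≡-mod-Reasoning M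

      fiber⊆steps : ∀ {a y} → InFiber M p a y → ∃ λ r → r ℕ.< p × y ≡ step e a r
      fiber⊆steps {a} {y} (s , sp≡M , r , r<p , y≡a+rs)
        with ℕ.*-cancelʳ-≡ s e p {{ℕ.m*n≢0⇒n≢0 e {{subst NonZero (sym ep≡M) M≢0}}}} (trans sp≡M (sym ep≡M))
      ... | refl = r , r<p , ⟦⟧-injective-mod (begin
        ⟦ y ⟧                       ≈⟨ Cong⇒≡-mod y≡a+rs ⟩
        + (toℕ a ℕ.+ r ℕ.* s)       ≡⟨ pos-+-* (toℕ a) r s ⟩
        ⟦ a ⟧ + + r * + s           ≈⟨ ≡-mod-sym (residue-≡-mod M _) ⟩
        ⟦ step s a r ⟧              ∎)
        where open ≡-mod-Reasoning M

      InFibSet? : ∀ a → Dec (InFibSet M A p a)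
      InFibSet? a = map′ fromSteps toSteps ((a ∈? A) ×-dec ℕ.allUpTo? (λ r → step e a r ∈? A) p)
        where
        fromSteps : a ∈ A × (∀ {r} → r ℕ.< p → step e a r ∈ A) → InFibSet M A p a
        fromSteps (a∈A , steps⊆A) = a∈A , λ y y∈fiber →
          let r , r<p , y≡step = fiber⊆steps {a} y∈fiber in subst (_∈ A) (sym y≡step) (steps⊆A r<p)
        toSteps : InFibSet M A p a → a ∈ A × (∀ {r} → r ℕ.< p → step e a r ∈ A)
        toSteps (a∈A , fiber⊆A) = a∈A , λ r<p → fiber⊆A _ (step∈fiber a r<p)

    fibered⇒InFibSet : ∀ {p S a} → Fibered M p S → (∀ {y} → S y → y ∈ A) → S a → InFibSet M A p a
    fibered⇒InFibSet S-fibered S⊆A a∈S = S⊆A a∈S , λ y y∈fiber → S⊆A (S-fibered _ y a∈S y∈fiber)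

  module _ (M D : ℕ) {x y : Fin M} where

    ∈-Grid⁺ : ⟦ x ⟧ ≡ ⟦ y ⟧ [mod D ] → y ∈ Grid M D x
    ∈-Grid⁺ x≡y = ∈-toSubset⁺ {P = InGrid M D x} (λ y → Cong? D (toℕ x) (toℕ y)) (≡-mod⇒Cong x≡y)

    ∈-Grid⁻ : y ∈ Grid M D x → ⟦ x ⟧ ≡ ⟦ y ⟧ [mod D ]
    ∈-Grid⁻ y∈Λ = Cong⇒≡-mod (∈-toSubset⁻ {P = InGrid M D x} (λ y → Cong? D (toℕ x) (toℕ y)) y∈Λ)

  grid-size : ∀ M D k .{{_ : NonZero M}} .{{_ : NonZero D}} → D ℕ.* k ≡ M → ∀ x → k ℕ.≤ ∣ Grid M D x ∣
  grid-size M D k Dk≡M x =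
    subst (ℕ._≤ ∣ Grid M D x ∣) (∣⊤∣≡n k)
      (∣p∣≤∣q∣-injection ⊤ (Grid M D x) shift
        (λ {r} _ → shift∈Λ {r}) (λ {r} {r'} _ _ → shift-injective {r} {r'}))
    where
    shift : Fin k → Fin M
    shift r = residue M (⟦ x ⟧ + ⟦ r ⟧ * + D)
    shift∈Λ : ∀ {r} → shift r ∈ Grid M D x
    shift∈Λ {r} = ∈-Grid⁺ M D (begin
      ⟦ x ⟧                   ≡⟨ sym (ℤ.+-identityʳ _) ⟩
      ⟦ x ⟧ + + 0             ≈⟨ +-congˡ-mod ⟦ x ⟧ (≡-mod-sym (multiple≡0-mod ⟦ r ⟧)) ⟩
      ⟦ x ⟧ + ⟦ r ⟧ * + D     ≈⟨ ≡-mod-divisor (ℕ.divides k (trans (sym Dk≡M) (ℕ.*-comm D k)))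
                                                 (≡-mod-sym (residue-≡-mod M _)) ⟩
      ⟦ shift r ⟧             ∎)
      where open ≡-mod-Reasoning D
    shift-injective : ∀ {r r'} → shift r ≡ shift r' → r ≡ r'
    shift-injective {r} {r'} eq =
      ⟦⟧-injective-mod (*-cancelʳ-mod D (subst (⟦ r ⟧ * + D ≡ ⟦ r' ⟧ * + D [mod_]) (sym Dk≡M)
      (+-cancelˡ-mod ⟦ x ⟧ (begin
        ⟦ x ⟧ + ⟦ r ⟧ * + D     ≈⟨ ≡-mod-sym (residue-≡-mod M _) ⟩
        ⟦ shift r ⟧             ≡⟨ cong ⟦_⟧ eq ⟩
        ⟦ shift r' ⟧            ≈⟨ residue-≡-mod M _ ⟩
        ⟦ x ⟧ + ⟦ r' ⟧ * + D    ∎))))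
      where open ≡-mod-Reasoning M

  module _ (M : ℕ) (A B : Subset M) (D : ℕ) {x : Fin M} where

    InSigma? : Decidable (InSigma M A B D x)
    InSigma? a = (a ∈? A) ×-dec any? (λ b → (b ∈? B) ×-dec Cong? D (toℕ x) (toℕ a ℕ.+ toℕ b))

    ∈-Sigma⁺ : ∀ {a} → a ∈ A → ∀ {b} → b ∈ B → ⟦ x ⟧ ≡ ⟦ a ⟧ + ⟦ b ⟧ [mod D ] → a ∈ Sigma M A B D x
    ∈-Sigma⁺ {a} a∈A {b} b∈B x≡a+b = ∈-toSubset⁺ InSigma?
      (a∈A , b , b∈B , ≡-mod⇒Cong (≡-mod-trans x≡a+b (≡⇒≡-mod (sym (⟦+⟧ a b)))))

    ∈-Sigma⁻ : ∀ {a} → a ∈ Sigma M A B D x → a ∈ A × ∃ λ b → b ∈ B × ⟦ x ⟧ ≡ ⟦ a ⟧ + ⟦ b ⟧ [mod D ]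
    ∈-Sigma⁻ {a} a∈Σ =
      let a∈A , b , b∈B , x≡a+b = ∈-toSubset⁻ InSigma? a∈Σ
      in a∈A , b , b∈B , ≡-mod-trans (Cong⇒≡-mod x≡a+b) (≡⇒≡-mod (⟦+⟧ a b))

  module TilingProperties (M : ℕ) {{M≢0 : NonZero M}} (A B : Subset M) (A⊕B : Tiling M A B) where

    record Decomposition (y : Fin M) : Set where
      field
        summandᴬ summandᴮ : Fin M
        summandᴬ∈A : summandᴬ ∈ A
        summandᴮ∈B : summandᴮ ∈ B
        sum≡ : ⟦ summandᴬ ⟧ + ⟦ summandᴮ ⟧ ≡ ⟦ y ⟧ [mod M ]

    decompose : ∀ y → Decomposition y
    decompose y =
      let a , b , a∈A , b∈B , a+b≡y = proj₁ A⊕B y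
      in record { summandᴬ∈A = a∈A ; summandᴮ∈B = b∈B
                ; sum≡ = ≡-mod-trans (≡⇒≡-mod (sym (⟦+⟧ a b))) (Cong⇒≡-mod a+b≡y) }

    tiling-unique : ∀ {a a' b b'} → a ∈ A → a' ∈ A → b ∈ B → b' ∈ B →
      ⟦ a ⟧ + ⟦ b ⟧ ≡ ⟦ a' ⟧ + ⟦ b' ⟧ [mod M ] → a ≡ a'
    tiling-unique {a} {a'} {b} {b'} a∈A a'∈A b∈B b'∈B a+b≡a'+b' =
      proj₁ (proj₂ A⊕B z a a' b b' a∈A a'∈A b∈B b'∈B
        (represents a b (≡-mod-sym (residue-≡-mod M _)))
        (represents a' b' (≡-mod-trans (≡-mod-sym a+b≡a'+b') (≡-mod-sym (residue-≡-mod M _)))))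
      where
      z : Fin M
      z = residue M (⟦ a ⟧ + ⟦ b ⟧)
      represents : ∀ c d → ⟦ c ⟧ + ⟦ d ⟧ ≡ ⟦ z ⟧ [mod M ] → Cong M (toℕ c ℕ.+ toℕ d) (toℕ z)
      represents c d c+d≡z = ≡-mod⇒Cong (≡-mod-trans (≡⇒≡-mod (⟦+⟧ c d)) c+d≡z)

    module _ (D : ℕ) (D∣M : D ℕ.∣ M)
      (B-separated : ∀ {b b'} → b ∈ B → b' ∈ B → ⟦ b ⟧ ≡ ⟦ b' ⟧ [mod D ] → b ≡ b')
      (x : Fin M) where

      private
        -- A b ∈ B with a + b ∈ Λ; meaningless outside Σ_A(Λ).
        partner : Fin M → Fin M
        partner a with any? (λ b → (b ∈? B) ×-dec Cong? D (toℕ x) (toℕ a ℕ.+ toℕ b))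
        ... | yes (b , _) = b
        ... | no _ = a

        partner-spec : ∀ {a} → a ∈ Sigma M A B D x →
          partner a ∈ B × ⟦ x ⟧ ≡ ⟦ a ⟧ + ⟦ partner a ⟧ [mod D ]
        partner-spec {a} a∈Σ with any? (λ b → (b ∈? B) ×-dec Cong? D (toℕ x) (toℕ a ℕ.+ toℕ b))
        ... | yes (b , b∈B , x≡a+b) = b∈B , ≡-mod-trans (Cong⇒≡-mod x≡a+b) (≡⇒≡-mod (⟦+⟧ a b))
        ... | no ∄b = ⊥-elim (∄b (proj₂ (∈-toSubset⁻ (InSigma? M A B D) a∈Σ)))

        Σ→Λ : Fin M → Fin M
        Σ→Λ a = residue M (⟦ a ⟧ + ⟦ partner a ⟧)

        Σ→Λ-∈ : ∀ {a} → a ∈ Sigma M A B D x → Σ→Λ a ∈ Grid M D x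
        Σ→Λ-∈ a∈Σ = ∈-Grid⁺ M D (≡-mod-trans (proj₂ (partner-spec a∈Σ))
                                              (≡-mod-divisor D∣M (≡-mod-sym (residue-≡-mod M _))))

        Σ→Λ-injective : ∀ {a a'} → a ∈ Sigma M A B D x → a' ∈ Sigma M A B D x → Σ→Λ a ≡ Σ→Λ a' → a ≡ a'
        Σ→Λ-injective a∈Σ a'∈Σ eq =
          tiling-unique (proj₁ (∈-Sigma⁻ M A B D a∈Σ)) (proj₁ (∈-Sigma⁻ M A B D a'∈Σ))
            (proj₁ (partner-spec a∈Σ)) (proj₁ (partner-spec a'∈Σ))
            (≡-mod-trans (≡-mod-sym (residue-≡-mod M _)) (≡-mod-trans (≡⇒≡-mod (cong ⟦_⟧ eq)) (residue-≡-mod M _)))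

        Λ→Σ : Fin M → Fin M
        Λ→Σ y = Decomposition.summandᴬ (decompose y)

        Λ→Σ-∈ : ∀ {y} → y ∈ Grid M D x → Λ→Σ y ∈ Sigma M A B D x
        Λ→Σ-∈ {y} y∈Λ = ∈-Sigma⁺ M A B D summandᴬ∈A summandᴮ∈B
          (≡-mod-trans (∈-Grid⁻ M D y∈Λ) (≡-mod-divisor D∣M (≡-mod-sym sum≡)))
          where open Decomposition (decompose y)

        summandᴬ≡⇒summandᴮ≡ : ∀ {y y'} → y ∈ Grid M D x → y' ∈ Grid M D x → Λ→Σ y ≡ Λ→Σ y' →
          Decomposition.summandᴮ (decompose y) ≡ Decomposition.summandᴮ (decompose y')
        summandᴬ≡⇒summandᴮ≡ {y} {y'} y∈Λ y'∈Λ a≡a' =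
          B-separated (summandᴮ∈B d) (summandᴮ∈B d') (+-cancelˡ-mod ⟦ summandᴬ d ⟧ (begin
            ⟦ summandᴬ d ⟧ + ⟦ summandᴮ d ⟧     ≈⟨ ≡-mod-divisor D∣M (sum≡ d) ⟩
            ⟦ y ⟧                               ≈⟨ ≡-mod-sym (∈-Grid⁻ M D y∈Λ) ⟩
            ⟦ x ⟧                               ≈⟨ ∈-Grid⁻ M D y'∈Λ ⟩
            ⟦ y' ⟧                              ≈⟨ ≡-mod-divisor D∣M (≡-mod-sym (sum≡ d')) ⟩
            ⟦ summandᴬ d' ⟧ + ⟦ summandᴮ d' ⟧   ≡⟨ cong (λ c → ⟦ c ⟧ + ⟦ summandᴮ d' ⟧) (sym a≡a') ⟩
            ⟦ summandᴬ d ⟧ + ⟦ summandᴮ d' ⟧    ∎))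
          where
          open Decomposition
          open ≡-mod-Reasoning D
          d : Decomposition y
          d = decompose y
          d' : Decomposition y'
          d' = decompose y'

        Λ→Σ-injective : ∀ {y y'} → y ∈ Grid M D x → y' ∈ Grid M D x → Λ→Σ y ≡ Λ→Σ y' → y ≡ y'
        Λ→Σ-injective {y} {y'} y∈Λ y'∈Λ a≡a' = ⟦⟧-injective-mod (begin
          ⟦ y ⟧                               ≈⟨ ≡-mod-sym (sum≡ d) ⟩
          ⟦ summandᴬ d ⟧ + ⟦ summandᴮ d ⟧     ≡⟨ cong₂ (λ c e → ⟦ c ⟧ + ⟦ e ⟧) a≡a'
                                                   (summandᴬ≡⇒summandᴮ≡ y∈Λ y'∈Λ a≡a') ⟩
          ⟦ summandᴬ d' ⟧ + ⟦ summandᴮ d' ⟧   ≈⟨ sum≡ d' ⟩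
          ⟦ y' ⟧                              ∎)
          where
          open Decomposition
          open ≡-mod-Reasoning M
          d : Decomposition y
          d = decompose y
          d' : Decomposition y'
          d' = decompose y'

      ∣Σ∣≡∣Λ∣ : ∣ Sigma M A B D x ∣ ≡ ∣ Grid M D x ∣
      ∣Σ∣≡∣Λ∣ = ℕ.≤-antisym
        (∣p∣≤∣q∣-injection _ _ Σ→Λ Σ→Λ-∈ Σ→Λ-injective)
        (∣p∣≤∣q∣-injection _ _ Λ→Σ Λ→Σ-∈ Λ→Σ-injective)

      A⊆Σ : ∣ A ∣ ℕ.≤ ∣ Grid M D x ∣ → ∀ {a} → a ∈ A → a ∈ Sigma M A B D x
      A⊆Σ ∣A∣≤∣Λ∣ {a} a∈A with a ∈? Sigma M A B D x
      ... | yes a∈Σ = a∈Σ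
      ... | no a∉Σ = ⊥-elim (ℕ.<-irrefl refl (begin-strict
        ∣ Sigma M A B D x ∣   ≤⟨ p⊆q⇒∣p∣≤∣q∣ Σ⊆A-a ⟩
        ∣ A ─ a ∣              <⟨ x∈p⇒∣p-x∣<∣p∣ a∈A ⟩
        ∣ A ∣                  ≤⟨ ∣A∣≤∣Λ∣ ⟩
        ∣ Grid M D x ∣         ≡⟨ sym ∣Σ∣≡∣Λ∣ ⟩
        ∣ Sigma M A B D x ∣   ∎))
        where
        open ℕ.≤-Reasoning
        Σ⊆A-a : Sigma M A B D x ⊆ A ─ a
        Σ⊆A-a a'∈Σ = x∈p∧x≢y⇒x∈p-y (proj₁ (∈-Sigma⁻ M A B D a'∈Σ)) (λ { refl → a∉Σ a'∈Σ })

    open Fibers M A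

    meeting-fibers⇒same-piece : ∀ {D p q e f a b a' b'} → e ℕ.* p ≡ M → f ℕ.* q ≡ M →
      a ∈ A → b ∈ B → a' ∈ A → b' ∈ B → Fibered M p (Piece D a) → Fibered M q (Piece D a') →
      ∀ {s t} → s ℕ.< p → t ℕ.< q → ⟦ a ⟧ + ⟦ b ⟧ + + s * + e ≡ ⟦ a' ⟧ + ⟦ b' ⟧ + + t * + f [mod M ] →
      Piece D a a'
    meeting-fibers⇒same-piece {D} {p} {q} {e} {f} {a} {b} {a'} {b'} ep≡M fq≡M a∈A b∈B a'∈A b'∈B
      a-fibered a'-fibered {s} {t} s<p t<q sums-meet = a'∈A , ≡-mod⇒Cong (begin
        ⟦ a ⟧    ≈⟨ Cong⇒≡-mod (proj₂ y∈Piece-a) ⟩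
        ⟦ y ⟧    ≡⟨ cong ⟦_⟧ y≡z ⟩
        ⟦ z ⟧    ≈⟨ ≡-mod-sym (Cong⇒≡-mod (proj₂ z∈Piece-a')) ⟩
        ⟦ a' ⟧   ∎)
      where
      open ≡-mod-Reasoning D
      y z : Fin M
      y = step e a s
      z = step f a' t
      y∈Piece-a : Piece D a y
      y∈Piece-a = a-fibered a y (∈-own-piece a∈A) (step∈fiber ep≡M a s<p)
      z∈Piece-a' : Piece D a' z
      z∈Piece-a' = a'-fibered a' z (∈-own-piece a'∈A) (step∈fiber fq≡M a' t<q)
      y≡z : y ≡ z
      y≡z = tiling-unique (proj₁ y∈Piece-a) (proj₁ z∈Piece-a') b∈B b'∈B
        (≡-mod-trans (+-cong-mod (residue-≡-mod M (⟦ a ⟧ + + s * + e)) (≡-mod-refl {x = ⟦ b ⟧}))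
        (≡-mod-trans (≡⇒≡-mod (shuffle ⟦ a ⟧ (+ s * + e) ⟦ b ⟧))
        (≡-mod-trans sums-meet
        (≡-mod-trans (≡⇒≡-mod (sym (shuffle ⟦ a' ⟧ (+ t * + f) ⟦ b' ⟧)))
                     (+-cong-mod (≡-mod-sym (residue-≡-mod M (⟦ a' ⟧ + + t * + f))) (≡-mod-refl {x = ⟦ b' ⟧}))))))
        where shuffle : ∀ u v w → u + v + w ≡ u + w + v
              shuffle = solve-∀

    clash : ∀ {D} g {q₁ q₂} → Prime q₁ → Prime q₂ → q₁ ≢ q₂ → g ℕ.* q₂ ℕ.* q₁ ≡ M →
      ∀ {a b a' b'} → a ∈ A → b ∈ B → a' ∈ A → b' ∈ B →
      Fibered M q₁ (Piece D a) → Fibered M q₂ (Piece D a') →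
      ⟦ a ⟧ + ⟦ b ⟧ ≡ ⟦ a' ⟧ + ⟦ b' ⟧ [mod g ] → InFibSet M A q₁ a'
    clash g {q₁} {q₂} pq₁ pq₂ q₁≢q₂ gq₂q₁≡M a∈A b∈B a'∈A b'∈B a-fibered a'-fibered sums≡ =
      let s , t , s<q₁ , t<q₂ , sums-meet = fibers-meet g pq₁ pq₂ q₁≢q₂ sums≡
      in fibered⇒InFibSet a-fibered proj₁
           (meeting-fibers⇒same-piece gq₂q₁≡M (trans (xy∙z≈xz∙y g q₁ q₂) gq₂q₁≡M) a∈A b∈B a'∈A b'∈B
              a-fibered a'-fibered s<q₁ t<q₂ (subst (_≡_[mod_] _ _) gq₂q₁≡M sums-meet))

  Div-condition⇒separated : ∀ {M D} (B : Subset M) → D ℕ.∣ M →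
    (∀ m → ((D ℕ.∣ m × m ℕ.∣ M) × InDiv M B m) → m ≡ M) →
    ∀ {b b'} → b ∈ B → b' ∈ B → ⟦ b ⟧ ≡ ⟦ b' ⟧ [mod D ] → b ≡ b'
  Div-condition⇒separated {M} {D} B D∣M only-M {b} {b'} b∈B b'∈B (≡-mod D∣b-b') =
    ⟦⟧-injective-mod (≡-mod (∣ᵤ⇒∣ (subst (ℕ._∣ n) gcd≡M (gcd[m,n]∣m n M))))
    where
    n : ℕ
    n = ℤ.∣ ⟦ b ⟧ - ⟦ b' ⟧ ∣
    gcd≡M : gcd n M ≡ M
    gcd≡M = only-M (gcd n M) ((gcd-greatest (∣⇒∣ᵤ D∣b-b') D∣M , gcd[m,n]∣n n M) , b , b' , b∈B , b'∈B , refl)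

  module ThreeDirections
    (M D : ℕ) {{M≢0 : NonZero M}}
    {pᵢ pⱼ pₖ : ℕ} (pᵢ-prime : Prime pᵢ) (pⱼ-prime : Prime pⱼ) (pₖ-prime : Prime pₖ)
    (i≢j : pᵢ ≢ pⱼ) (i≢k : pᵢ ≢ pₖ) (j≢k : pⱼ ≢ pₖ) (M≡ : D ℕ.* (pᵢ ℕ.* pⱼ ℕ.* pₖ) ≡ M)
    (A B : Subset M) (A⊕B : Tiling M A B)
    (B-separated : ∀ {b b'} → b ∈ B → b' ∈ B → ⟦ b ⟧ ≡ ⟦ b' ⟧ [mod D ] → b ≡ b')
    (pieces-fibered : ∀ a → a ∈ A →
       Fibered M pᵢ (Fibers.Piece M A D a) ⊎ Fibered M pⱼ (Fibers.Piece M A D a)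
       ⊎ Fibered M pₖ (Fibers.Piece M A D a))
    where

    open Fibers M A
    open TilingProperties M A B A⊕B

    CoveredBy : ℕ → ℕ → Set
    CoveredBy p q = ∀ a → a ∈ A → InFibSet M A p a ⊎ InFibSet M A q a

    record Uncovered (p q : ℕ) : Set where
      field
        point : Fin M
        point∈A : point ∈ A
        ∉p : ¬ InFibSet M A p point
        ∉q : ¬ InFibSet M A q point

    private
      instance
        D≢0 : NonZero D
        D≢0 = ℕ.m*n≢0⇒m≢0 D {{subst NonZero (sym M≡) M≢0}}

      module _ (e f : ℕ) {p q : ℕ} (ep≡M : e ℕ.* p ≡ M) (fq≡M : f ℕ.* q ≡ M) where

        covered-at? : ∀ a → Dec (a ∈ A → InFibSet M A p a ⊎ InFibSet M A q a)
        covered-at? a = (a ∈? A) →-dec (InFibSet? {p} {e} ep≡M a ⊎-dec InFibSet? {q} {f} fq≡M a)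

        covered? : Dec (CoveredBy p q)
        covered? = all? covered-at?

        uncovered : ¬ CoveredBy p q → Uncovered p q
        uncovered ¬covered with ¬∀⟶∃¬ M _ covered-at? ¬covered
        ... | a , ¬covered-a with a ∈? A
        ...   | yes a∈A = record { point = a ; point∈A = a∈A
                                 ; ∉p = λ a∈p → ¬covered-a (λ _ → inj₁ a∈p)
                                 ; ∉q = λ a∈q → ¬covered-a (λ _ → inj₂ a∈q) }
        ...   | no a∉A = ⊥-elim (¬covered-a (λ a∈A → ⊥-elim (a∉A a∈A)))

      D∣M : D ℕ.∣ M
      D∣M = ℕ.divides (pᵢ ℕ.* pⱼ ℕ.* pₖ) (trans (sym M≡) (ℕ.*-comm D _))

      factor∣M : ∀ {g q₁ q₂} → g ℕ.* q₂ ℕ.* q₁ ≡ M → g ℕ.∣ M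
      factor∣M {g} {q₁} {q₂} gq₂q₁≡M = ℕ.divides (q₂ ℕ.* q₁) (trans (sym gq₂q₁≡M) (regroup g q₁ q₂))
        where regroup : ∀ g q₁ q₂ → g ℕ.* q₂ ℕ.* q₁ ≡ q₂ ℕ.* q₁ ℕ.* g
              regroup = ℕ-Solver.solve-∀

      eᵢ eⱼ eₖ : ℕ
      eᵢ = D ℕ.* pₖ ℕ.* pⱼ
      eⱼ = D ℕ.* pᵢ ℕ.* pₖ
      eₖ = D ℕ.* pⱼ ℕ.* pᵢ

      M≡ᵢ : eᵢ ℕ.* pᵢ ≡ M
      M≡ᵢ = trans (regroup pᵢ pⱼ pₖ D) M≡
        where regroup : ∀ pᵢ pⱼ pₖ D → D ℕ.* pₖ ℕ.* pⱼ ℕ.* pᵢ ≡ D ℕ.* (pᵢ ℕ.* pⱼ ℕ.* pₖ)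
              regroup = ℕ-Solver.solve-∀

      M≡ⱼ : eⱼ ℕ.* pⱼ ≡ M
      M≡ⱼ = trans (regroup pᵢ pⱼ pₖ D) M≡
        where regroup : ∀ pᵢ pⱼ pₖ D → D ℕ.* pᵢ ℕ.* pₖ ℕ.* pⱼ ≡ D ℕ.* (pᵢ ℕ.* pⱼ ℕ.* pₖ)
              regroup = ℕ-Solver.solve-∀

      M≡ₖ : eₖ ℕ.* pₖ ≡ M
      M≡ₖ = trans (regroup pᵢ pⱼ pₖ D) M≡
        where regroup : ∀ pᵢ pⱼ pₖ D → D ℕ.* pⱼ ℕ.* pᵢ ℕ.* pₖ ≡ D ℕ.* (pᵢ ℕ.* pⱼ ℕ.* pₖ)
              regroup = ℕ-Solver.solve-∀

      fibered-piece⇒InFibSet : ∀ {p a} → a ∈ A → Fibered M p (Piece D a) → InFibSet M A p a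
      fibered-piece⇒InFibSet a∈A a-fibered = fibered⇒InFibSet a-fibered proj₁ (∈-own-piece a∈A)

      module _ {p q : ℕ} (w : Uncovered p q) where
        open Uncovered w

        fibered-in-other : ∀ {r} →
          Fibered M p (Piece D point) ⊎ Fibered M q (Piece D point) ⊎ Fibered M r (Piece D point) →
          Fibered M r (Piece D point)
        fibered-in-other = [ ⊥-elim ∘ ∉p ∘ fibered-piece⇒InFibSet point∈A
                           , [ ⊥-elim ∘ ∉q ∘ fibered-piece⇒InFibSet point∈A , id ]′ ]′

      fiberedₖ : (w : Uncovered pᵢ pⱼ) → Fibered M pₖ (Piece D (Uncovered.point w))
      fiberedₖ w = fibered-in-other w (pieces-fibered _ (Uncovered.point∈A w))

      fiberedⱼ : (w : Uncovered pᵢ pₖ) → Fibered M pⱼ (Piece D (Uncovered.point w))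
      fiberedⱼ w = fibered-in-other w
        ([ inj₁ , [ inj₂ ∘ inj₂ , inj₂ ∘ inj₁ ]′ ]′ (pieces-fibered _ (Uncovered.point∈A w)))

      fiberedᵢ : (w : Uncovered pⱼ pₖ) → Fibered M pᵢ (Piece D (Uncovered.point w))
      fiberedᵢ w = fibered-in-other w
        ([ inj₂ ∘ inj₂ , [ inj₁ , inj₂ ∘ inj₁ ]′ ]′ (pieces-fibered _ (Uncovered.point∈A w)))

      no-three-uncovered : ∣ A ∣ ≡ pᵢ ℕ.* pⱼ ℕ.* pₖ →
        Uncovered pᵢ pⱼ → Uncovered pᵢ pₖ → Uncovered pⱼ pₖ → ⊥
      no-three-uncovered ∣A∣≡ wₖ wⱼ wᵢ =
        let P , P≡uₖ , P≡uᵢ , P≡uⱼ =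
              grid-crt D pᵢ-prime pⱼ-prime pₖ-prime i≢j i≢k j≢k (sum≡x wₖ) (sum≡x wᵢ) (sum≡x wⱼ)
        in P-clashes P P≡uₖ P≡uᵢ P≡uⱼ
        where
        open Uncovered
        x : Fin M
        x = point wₖ
        A⊆Σₓ : ∀ {a} → a ∈ A → a ∈ Sigma M A B D x
        A⊆Σₓ = A⊆Σ D D∣M B-separated x
          (subst (ℕ._≤ ∣ Grid M D x ∣) (sym ∣A∣≡) (grid-size M D (pᵢ ℕ.* pⱼ ℕ.* pₖ) M≡ x))
        partner : ∀ {p q} → Uncovered p q → Fin M
        partner w = proj₁ (proj₂ (∈-Sigma⁻ M A B D (A⊆Σₓ (point∈A w))))
        partner∈B : ∀ {p q} (w : Uncovered p q) → partner w ∈ B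
        partner∈B w = proj₁ (proj₂ (proj₂ (∈-Sigma⁻ M A B D (A⊆Σₓ (point∈A w)))))
        sum : ∀ {p q} → Uncovered p q → ℤ
        sum w = ⟦ point w ⟧ + ⟦ partner w ⟧
        sum≡x : ∀ {p q} (w : Uncovered p q) → sum w ≡ ⟦ x ⟧ [mod D ]
        sum≡x w = ≡-mod-sym (proj₂ (proj₂ (proj₂ (∈-Sigma⁻ M A B D (A⊆Σₓ (point∈A w))))))

        P-clashes : ∀ P → P ≡ sum wₖ [mod D ℕ.* pᵢ ] → P ≡ sum wᵢ [mod D ℕ.* pⱼ ] →
          P ≡ sum wⱼ [mod D ℕ.* pₖ ] → ⊥
        P-clashes P P≡uₖ P≡uᵢ P≡uⱼ =
          [ fiberedᵢ-case , [ fiberedⱼ-case , fiberedₖ-case ]′ ]′ (pieces-fibered summandᴬ summandᴬ∈A)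
          where
          open Decomposition (decompose (residue M P))
          summands≡ : ∀ {g q₁ q₂ u} → g ℕ.* q₂ ℕ.* q₁ ≡ M → P ≡ u [mod g ] →
            ⟦ summandᴬ ⟧ + ⟦ summandᴮ ⟧ ≡ u [mod g ]
          summands≡ gq₂q₁≡M P≡u =
            ≡-mod-trans (≡-mod-divisor (factor∣M gq₂q₁≡M) (≡-mod-trans sum≡ (residue-≡-mod M P))) P≡u
          fiberedᵢ-case : Fibered M pᵢ (Piece D summandᴬ) → ⊥
          fiberedᵢ-case fibered = ∉p wⱼ (clash (D ℕ.* pₖ) pᵢ-prime pⱼ-prime i≢j M≡ᵢ summandᴬ∈A summandᴮ∈B
            (point∈A wⱼ) (partner∈B wⱼ) fibered (fiberedⱼ wⱼ) (summands≡ M≡ᵢ P≡uⱼ))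
          fiberedⱼ-case : Fibered M pⱼ (Piece D summandᴬ) → ⊥
          fiberedⱼ-case fibered = ∉q wₖ (clash (D ℕ.* pᵢ) pⱼ-prime pₖ-prime j≢k M≡ⱼ summandᴬ∈A summandᴮ∈B
            (point∈A wₖ) (partner∈B wₖ) fibered (fiberedₖ wₖ) (summands≡ M≡ⱼ P≡uₖ))
          fiberedₖ-case : Fibered M pₖ (Piece D summandᴬ) → ⊥
          fiberedₖ-case fibered = ∉q wᵢ (clash (D ℕ.* pⱼ) pₖ-prime pᵢ-prime (≢-sym i≢k) M≡ₖ summandᴬ∈A summandᴮ∈B
            (point∈A wᵢ) (partner∈B wᵢ) fibered (fiberedᵢ wᵢ) (summands≡ M≡ₖ P≡uᵢ))

    two-directions-suffice : ∣ A ∣ ≡ pᵢ ℕ.* pⱼ ℕ.* pₖ → CoveredBy pᵢ pⱼ ⊎ CoveredBy pᵢ pₖ ⊎ CoveredBy pⱼ pₖ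
    two-directions-suffice ∣A∣≡ with covered? eᵢ eⱼ M≡ᵢ M≡ⱼ | covered? eᵢ eₖ M≡ᵢ M≡ₖ | covered? eⱼ eₖ M≡ⱼ M≡ₖ
    ... | yes ij | _      | _      = inj₁ ij
    ... | no _   | yes ik | _      = inj₂ (inj₁ ik)
    ... | no _   | no _   | yes jk = inj₂ (inj₂ jk)
    ... | no ¬ij | no ¬ik | no ¬jk =
      ⊥-elim (no-three-uncovered ∣A∣≡
        (uncovered eᵢ eⱼ M≡ᵢ M≡ⱼ ¬ij) (uncovered eᵢ eₖ M≡ᵢ M≡ₖ ¬ik) (uncovered eⱼ eₖ M≡ⱼ M≡ₖ ¬jk))

open import Data.Nat using (_*_; _^_; _∸_; _≤_)
open import Data.Nat.Divisibility using (_∣_)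

lemma12p1 : (pi pj pk ni nj nk : ℕ)
  → Prime pi → Prime pj → Prime pk → pi ≢ pj → pi ≢ pk → pj ≢ pk
  → 1 ≤ ni → 1 ≤ nj → 1 ≤ nk
  → let M = pi ^ ni * pj ^ nj * pk ^ nk
        D = pi ^ (ni ∸ 1) * pj ^ (nj ∸ 1) * pk ^ (nk ∸ 1)
    in (A B : Subset M) → Tiling M A B
  → (∀ a → a ∈ A →
       Fibered M pi (λ y → y ∈ A × InGrid M D a y)
       ⊎ Fibered M pj (λ y → y ∈ A × InGrid M D a y)
       ⊎ Fibered M pk (λ y → y ∈ A × InGrid M D a y))
  → (∀ m → (((D ∣ m) × (m ∣ M)) × InDiv M B m) ⇔ m ≡ M)
  → (∀ x → ∣ Sigma M A B D x ∣ ≡ ∣ Grid M D x ∣)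
    × (∣ A ∣ ≡ pi * pj * pk →
         (∀ a → a ∈ A → InFibSet M A pi a ⊎ InFibSet M A pj a)
         ⊎ (∀ a → a ∈ A → InFibSet M A pi a ⊎ InFibSet M A pk a)
         ⊎ (∀ a → a ∈ A → InFibSet M A pj a ⊎ InFibSet M A pk a))
lemma12p1 pi pj pk (suc a) (suc b) (suc c) pi-prime pj-prime pk-prime i≢j i≢k j≢k (s≤s z≤n) (s≤s z≤n) (s≤s z≤n)
          A B A⊕B pieces-fibered only-M =
  TilingProperties.∣Σ∣≡∣Λ∣ M A B A⊕B D D∣M B-separated ,
  ThreeDirections.two-directions-suffice M D pi-prime pj-prime pk-prime i≢j i≢k j≢k M≡ A B A⊕B
    B-separated pieces-fibered
  where
  D M : ℕ
  D = pi ^ a * pj ^ b * pk ^ c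
  M = pi ^ suc a * pj ^ suc b * pk ^ suc c
  M≡ : D * (pi * pj * pk) ≡ M
  M≡ = regroup pi pj pk (pi ^ a) (pj ^ b) (pk ^ c)
    where regroup : ∀ pi pj pk X Y Z → X * Y * Z * (pi * pj * pk) ≡ pi * X * (pj * Y) * (pk * Z)
          regroup = ℕ-Solver.solve-∀
  instance
    _ = prime⇒nonZero pi-prime
    _ = prime⇒nonZero pj-prime
    _ = prime⇒nonZero pk-prime
    M≢0 : NonZero M
    M≢0 = ℕ.m*n≢0 (pi ^ suc a * pj ^ suc b) (pk ^ suc c)
            {{ℕ.m*n≢0 _ _ {{ℕ.m^n≢0 pi (suc a)}} {{ℕ.m^n≢0 pj (suc b)}}}} {{ℕ.m^n≢0 pk (suc c)}}
  D∣M : D ∣ M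
  D∣M = ℕ.divides (pi * pj * pk) (trans (sym M≡) (ℕ.*-comm D _))
  B-separated : ∀ {b b'} → b ∈ B → b' ∈ B → ⟦ b ⟧ ≡ ⟦ b' ⟧ [mod D ] → b ≡ b'
  B-separated = Div-condition⇒separated B D∣M (λ m → Equivalence.to (only-M m))
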